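{- For every integer $n>1$ and every $p\in\mathbb{N}$, the complete graph $K_n$ (unweighted) satisfies $\mathcal{C}_p(K_n)=\left((n-1)^{p+1}\right)^{1/p}$, and a radial spanning tree (one vertex joined by an edge to every other vertex) is a minimizer of the $L^p$-congestion for every $p\in\mathbb{N}$.
   Context: For an unweighted connected graph $G=(V,E)$, a spanning tree $T$ and $e\in E_T$, the congestion $\mathcal{C}(G,T,e)$ is the number of edges of $G$ with one endpoint in each of the two components of $T$ minus $e$; $\mathcal{C}_p(G,T)=\|(\mathcal{C}(G,T,e))_{e\in E_T}\|_p$ and $\mathcal{C}_p(G)=\min_T\mathcal{C}_p(G,T)$ over all spanning trees $T$ of $G$. -}

module Defs where

open import Data.Nat using (ℕ; zero; suc; _+_; _^_; _<ᵇ_)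
open import Data.Bool using (Bool; true; false; _∧_; _∨_; if_then_else_; not; T)
open import Data.Fin using (Fin; toℕ; _≟_)
open import Data.List using (List; []; _∷_; map; length; lookup; removeAt; allFin)
open import Data.Nat.ListAction using (sum)
open import Data.Bool.ListAction using (any)
open import Data.Product using (_×_; _,_; proj₁; proj₂)
open import Relation.Nullary using (¬_)
open import Relation.Nullary.Decidable using (⌊_⌋)
open import Relation.Binary.PropositionalEquality using (_≡_)

Edges : ℕ → Set
Edges n = List (Fin n × Fin n)

_==_ : ∀ {n} → Fin n → Fin n → Bool
x == y = ⌊ x ≟ y ⌋

reachB : ∀ {n} → ℕ → Edges n → Fin n → Fin n → Bool
reachB zero    E x y = x == y
reachB (suc k) E x y =
  (x == y) ∨ any (λ ab → ((proj₁ ab == x) ∧ reachB k E (proj₂ ab) y)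
                       ∨ ((proj₂ ab == x) ∧ reachB k E (proj₁ ab) y)) E

-- Reachability in the graph (Fin n, E): walks of length ≤ n suffice.
Reach : ∀ {n} → Edges n → Fin n → Fin n → Set
Reach {n} E x y = reachB n E x y ≡ true

-- T is a spanning tree of the complete graph K_n:
-- every edge of T is an edge of K_n (distinct endpoints), T is connected
-- (spans all vertices) and acyclic (every edge of T is a bridge, i.e. its
-- endpoints are disconnected in T minus that edge).
record IsSpanningTreeOfK (n : ℕ) (Tr : Edges n) : Set where
  field
    edgesOfK  : ∀ (i : Fin (length Tr)) → ¬ (proj₁ (lookup Tr i) ≡ proj₂ (lookup Tr i))
    connected : ∀ (x y : Fin n) → Reach Tr x y
    acyclic   : ∀ (i : Fin (length Tr)) →
                ¬ Reach (removeAt Tr i) (proj₁ (lookup Tr i)) (proj₂ (lookup Tr i))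

count : ∀ {A : Set} → (A → Bool) → List A → ℕ
count P []       = 0
count P (a ∷ as) = (if P a then 1 else 0) + count P as

congestion : ∀ {n} (Tr : Edges n) → Fin (length Tr) → ℕ
congestion {n} Tr i =
  sum (map (λ x → count (λ y → (toℕ x <ᵇ toℕ y) ∧ crosses x y) (allFin n)) (allFin n))
  where
    T' = removeAt Tr i
    u = proj₁ (lookup Tr i)
    v = proj₂ (lookup Tr i)
    crosses : Fin n → Fin n → Bool
    crosses x y = (reachB n T' u x ∧ reachB n T' v y) ∨ (reachB n T' v x ∧ reachB n T' u y)

-- p-th power of the L^p-congestion:  C_p(K_n,T)^p = Σ_{e ∈ E_T} C(K_n,T,e)^p.
congestionPowSum : ∀ {n} → ℕ → Edges n → ℕ
congestionPowSum p Tr = sum (map (λ i → congestion Tr i ^ p) (allFin (length Tr)))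

radialFrom : ∀ {n} → Fin n → List (Fin n) → Edges n
radialFrom c []       = []
radialFrom c (x ∷ xs) = if c == x then radialFrom c xs else ((c , x) ∷ radialFrom c xs)

radial : ∀ {n} → Fin n → Edges n
radial {n} c = radialFrom c (allFin n)

module Submission where

-- Deleting an edge uv of a spanning tree of K_n splits the vertices into the side S of u and its
-- complement, which contains v; every pair {x, y} with x ∈ S, y ∉ S crosses the cut, so the
-- congestion of the edge is at least |S| (n − |S|) ≥ n − 1. A connected graph on n vertices has at
-- least n − 1 edges, hence Σ_e C(e)^p ≥ (n − 1) (n − 1)^p. In the star every deleted edge cuts off
-- a single leaf, so all n − 1 edges have congestion exactly n − 1 and the bound is attained.

open import Defs
open import Data.Nat using (ℕ; zero; suc; _≤_; _<_; _∸_; _^_; _+_; _*_; z≤n; s≤s; _<ᵇ_)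
open import Data.Nat.Properties hiding (_≟_; suc-injective)
open import Data.Nat.ListAction using (sum)
open import Data.Fin using (Fin; zero; suc; toℕ; _≟_)
open import Data.Fin.Properties using (suc-injective; injective⇒≤)
open import Data.Bool using (Bool; true; false; T; not; _∧_; _∨_; _xor_; if_then_else_)
open import Data.Bool.Properties using (T-∧; T-∨; T-≡; T-not-≡; ¬-not)
open import Data.List using ([]; _∷_; map; length; lookup; removeAt; allFin; tabulate)
open import Data.List.Relation.Unary.Any as Any using (here; there)
open import Data.List.Relation.Unary.Any.Properties using (any⁺; any⁻)
open import Data.List.Relation.Unary.All as All using ()
open import Data.List.Relation.Unary.AllPairs using (_∷_)
open import Data.List.Relation.Unary.Unique.Propositional using (Unique)
open import Data.List.Relation.Unary.Unique.Propositional.Properties using (allFin⁺)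
open import Data.List.Membership.Propositional using (_∈_; find; lose)
open import Data.List.Membership.Propositional.Properties using (∈-lookup; ∈-allFin)
open import Data.List.Membership.Setoid.Properties using (index-injective)
open import Data.Product using (_×_; _,_; proj₁; proj₂; ∃-syntax)
open import Data.Sum using (_⊎_; inj₁; inj₂)
open import Data.Unit using (tt)
open import Data.Empty using (⊥-elim)
open import Function using (_∘_; id; Injective)
open import Function.Bundles using (Equivalence)
open import Relation.Nullary using (¬_; yes; no; contradiction)
open import Relation.Nullary.Decidable using (toWitness; fromWitness; isYes≗does)
open import Relation.Binary.PropositionalEquality
open import Algebra.Properties.CommutativeMonoid.Sum +-0-commutativeMonoid
  using (sum-syntax; sum-cong-≗; ∑-distrib-+)

open Equivalence using (to; from)

private
  variable
    n m k : ℕ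

indicator : Bool → ℕ
indicator b = if b then 1 else 0

indicator-T : ∀ {b} → T b → indicator b ≡ 1
indicator-T {true} _ = refl

indicator-mono : ∀ {a b} → (T a → T b) → indicator a ≤ indicator b
indicator-mono {false} _ = z≤n
indicator-mono {true} {true} _ = ≤-refl
indicator-mono {true} {false} a⇒b = ⊥-elim (a⇒b tt)

indicator-+-not : ∀ b → indicator b + indicator (not b) ≡ 1
indicator-+-not true = refl
indicator-+-not false = refl

xor-intro : ∀ a b → (T a × ¬ T b) ⊎ (¬ T a × T b) → T (a xor b)
xor-intro true  false _ = tt
xor-intro false true  _ = tt
xor-intro true  true  (inj₁ (_ , ¬b)) = ¬b tt
xor-intro true  true  (inj₂ (¬a , _)) = ¬a tt
xor-intro false false (inj₁ (() , _))
xor-intro false false (inj₂ (_ , ()))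

xor-cut : ∀ s s′ r r′ → T s ⊎ T r → T s′ ⊎ T r′ → T (s xor s′) → T ((s ∧ r′) ∨ (r ∧ s′))
xor-cut true  false r true  _          _          _  = tt
xor-cut false true  true r′ _          _          _  = tt
xor-cut true  false r false _          (inj₁ ())  _
xor-cut false true  false r′ (inj₁ ()) _          _
xor-cut true  true  r r′    _          _          ()
xor-cut false false r r′    _          _          ()

∑-mono-≤ : ∀ {f g : Fin n → ℕ} → (∀ i → f i ≤ g i) → ∑[ i < n ] f i ≤ ∑[ i < n ] g i
∑-mono-≤ {zero} f≤g = z≤n
∑-mono-≤ {suc n} f≤g = +-mono-≤ (f≤g zero) (∑-mono-≤ (f≤g ∘ suc))

∑-const : ∀ n k → ∑[ i < n ] k ≡ n * k
∑-const zero k = refl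
∑-const (suc n) k = cong (k +_) (∑-const n k)

term≤∑ : ∀ (f : Fin n → ℕ) i → f i ≤ ∑[ j < n ] f j
term≤∑ f zero = m≤m+n (f zero) _
term≤∑ f (suc i) = ≤-trans (term≤∑ (f ∘ suc) i) (m≤n+m _ (f zero))

sum-map-tabulate : ∀ {A : Set} (g : A → ℕ) (f : Fin n → A) →
                   sum (map g (tabulate f)) ≡ ∑[ i < n ] g (f i)
sum-map-tabulate {zero} g f = refl
sum-map-tabulate {suc n} g f = cong (g (f zero) +_) (sum-map-tabulate g (f ∘ suc))

count-tabulate : ∀ {A : Set} (P : A → Bool) (f : Fin n → A) →
                 count P (tabulate f) ≡ ∑[ i < n ] indicator (P (f i))
count-tabulate {zero} P f = refl
count-tabulate {suc n} P f = cong (indicator (P (f zero)) +_) (count-tabulate P (f ∘ suc))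

m+n∸1≤m*n : ∀ {m n} → 1 ≤ m → 1 ≤ n → m + n ∸ 1 ≤ m * n
m+n∸1≤m*n {suc a} {suc b} _ _ = begin
  a + suc b         ≡⟨ +-comm a (suc b) ⟩
  suc b + a         ≤⟨ +-monoʳ-≤ (suc b) (m≤m*n a (suc b)) ⟩
  suc b + a * suc b ∎
  where open ≤-Reasoning

^-+-1 : ∀ m p → m ^ (p + 1) ≡ m * m ^ p
^-+-1 m p = cong (m ^_) (+-comm p 1)

size : (Fin n → Bool) → ℕ
size {n} S = ∑[ x < n ] indicator (S x)

size-≥1 : ∀ (S : Fin n → Bool) x → T (S x) → 1 ≤ size S
size-≥1 S x Sx = ≤-trans (≤-reflexive (sym (indicator-T Sx))) (term≤∑ (indicator ∘ S) x)

size-+-size-not : ∀ (S : Fin n → Bool) → size S + size (not ∘ S) ≡ n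
size-+-size-not {n} S = begin
  size S + size (not ∘ S)                       ≡⟨ ∑-distrib-+ (indicator ∘ S) (indicator ∘ not ∘ S) ⟨
  ∑[ x < n ] (indicator (S x) + indicator (not (S x))) ≡⟨ sum-cong-≗ (indicator-+-not ∘ S) ⟩
  ∑[ x < n ] 1                                  ≡⟨ ∑-const n 1 ⟩
  n * 1                                         ≡⟨ *-identityʳ n ⟩
  n                                             ∎
  where open ≡-Reasoning

==-suc : ∀ (x y : Fin n) → (suc x == suc y) ≡ (x == y)
==-suc x y = trans (isYes≗does (suc x ≟ suc y)) (sym (isYes≗does (x ≟ y)))

size-== : ∀ (z : Fin n) → size (z ==_) ≡ 1
size-== {suc n} zero = cong suc (trans (∑-const n 0) (*-zeroʳ n))
size-== {suc n} (suc z) = trans (sum-cong-≗ (cong indicator ∘ ==-suc z)) (size-== z)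

size-not-== : ∀ (z : Fin n) → size (not ∘ (z ==_)) ≡ n ∸ 1
size-not-== {n} z = begin
  size (not ∘ (z ==_))                  ≡⟨ m+n∸m≡n 1 _ ⟨
  1 + size (not ∘ (z ==_)) ∸ 1          ≡⟨ cong (λ s → s + size (not ∘ (z ==_)) ∸ 1) (size-== z) ⟨
  size (z ==_) + size (not ∘ (z ==_)) ∸ 1 ≡⟨ cong (_∸ 1) (size-+-size-not (z ==_)) ⟩
  n ∸ 1                                 ∎
  where open ≡-Reasoning

crossings : (Fin n → Fin n → Bool) → ℕ
crossings {n} F = ∑[ x < n ] ∑[ y < n ] indicator ((toℕ x <ᵇ toℕ y) ∧ F x y)

crossings-mono : ∀ {F G : Fin n → Fin n → Bool} →
                 (∀ x y → T (F x y) → T (G x y)) → crossings F ≤ crossings G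
crossings-mono {F = F} F⇒G = ∑-mono-≤ λ x → ∑-mono-≤ λ y → indicator-mono (restrict x y)
  where
    restrict : ∀ x y → T ((toℕ x <ᵇ toℕ y) ∧ F x y) → T ((toℕ x <ᵇ toℕ y) ∧ _)
    restrict x y p = let (x<y , Fxy) = to T-∧ p in from T-∧ (x<y , F⇒G x y Fxy)

crossings-xor : ∀ (S : Fin n → Bool) →
                crossings (λ x y → S x xor S y) ≡ size S * size (not ∘ S)
crossings-xor {zero} S = refl
crossings-xor {suc n} S with S zero
... | true = cong (size (not ∘ S ∘ suc) +_) (crossings-xor (S ∘ suc))
... | false = trans (cong (size (S ∘ suc) +_) (crossings-xor (S ∘ suc)))
                    (sym (*-suc (size (S ∘ suc)) (size (not ∘ S ∘ suc))))

==-sound : ∀ {x y : Fin n} → T (x == y) → x ≡ y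
==-sound = toWitness

==-refl : ∀ (x : Fin n) → T (x == x)
==-refl x = fromWitness refl

Joins : Fin n × Fin n → Fin n → Fin n → Set
Joins e x w = (proj₁ e ≡ x × proj₂ e ≡ w) ⊎ (proj₂ e ≡ x × proj₁ e ≡ w)

Incident : Fin n × Fin n → Fin n → Set
Incident e z = proj₁ e ≡ z ⊎ proj₂ e ≡ z

private
  variable
    x y z w : Fin n
    e : Fin n × Fin n
    E : Edges n

Joins⇒Incidentˡ : Joins e x w → Incident e x
Joins⇒Incidentˡ (inj₁ (p , _)) = inj₁ p
Joins⇒Incidentˡ (inj₂ (p , _)) = inj₂ p

Joins⇒Incidentʳ : Joins e x w → Incident e w
Joins⇒Incidentʳ (inj₁ (_ , q)) = inj₂ q
Joins⇒Incidentʳ (inj₂ (_ , q)) = inj₁ q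

Joins-sameEdge : ∀ {x′ w′} → Joins e x w → Joins e x′ w′ → x ≡ x′ ⊎ (x ≡ w′ × w ≡ x′)
Joins-sameEdge (inj₁ (refl , refl)) (inj₁ (refl , refl)) = inj₁ refl
Joins-sameEdge (inj₁ (refl , refl)) (inj₂ (refl , refl)) = inj₂ (refl , refl)
Joins-sameEdge (inj₂ (refl , refl)) (inj₁ (refl , refl)) = inj₂ (refl , refl)
Joins-sameEdge (inj₂ (refl , refl)) (inj₂ (refl , refl)) = inj₁ refl

data Walk (E : Edges n) : ℕ → Fin n → Fin n → Set where
  stay : Walk E k x x
  step : e ∈ E → Joins e x w → Walk E k w y → Walk E (suc k) x y

Walk-suc : Walk E k x y → Walk E (suc k) x y
Walk-suc stay = stay
Walk-suc (step e∈E J walk) = step e∈E J (Walk-suc walk)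

Walk-mono : k ≤ m → Walk E k x y → Walk E m x y
Walk-mono {k} {m} k≤m walk with m≤n⇒m<n∨m≡n k≤m
... | inj₂ refl = walk
... | inj₁ (s≤s k≤m′) = Walk-suc (Walk-mono k≤m′ walk)

-- The test applied by `any` in the recursive clause of reachB.
viaEdge : ℕ → Edges n → Fin n → Fin n → Fin n × Fin n → Bool
viaEdge k E x y ab = ((proj₁ ab == x) ∧ reachB k E (proj₂ ab) y)
                   ∨ ((proj₂ ab == x) ∧ reachB k E (proj₁ ab) y)

reachB⇒Walk : ∀ k (E : Edges n) x y → T (reachB k E x y) → Walk E k x y
reachB⇒Walk zero E x y r with ==-sound {x = x} {y} r
... | refl = stay
reachB⇒Walk (suc k) E x y r with to (T-∨ {x == y}) r
... | inj₁ x≡y with ==-sound {x = x} {y} x≡y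
...   | refl = stay
reachB⇒Walk (suc k) E x y r | inj₂ q =
  let e , e∈E , viaE = find (any⁻ (viaEdge k E x y) E q) in viaEdge⇒Walk e e∈E viaE
  where
    viaEdge⇒Walk : ∀ e → e ∈ E → T (viaEdge k E x y e) → Walk E (suc k) x y
    viaEdge⇒Walk e e∈E p with to (T-∨ {(proj₁ e == x) ∧ _}) p
    ... | inj₁ q = let (e₁≡x , r) = to (T-∧ {proj₁ e == x}) q in
                   step e∈E (inj₁ (==-sound e₁≡x , refl)) (reachB⇒Walk k E _ y r)
    ... | inj₂ q = let (e₂≡x , r) = to (T-∧ {proj₂ e == x}) q in
                   step e∈E (inj₂ (==-sound e₂≡x , refl)) (reachB⇒Walk k E _ y r)

viaEdge⁺ : Joins e x w → T (reachB k E w y) → T (viaEdge k E x y e)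
viaEdge⁺ {e = e} {k = k} {E = E} {y = y} (inj₁ (refl , refl)) r =
  from (T-∨ {(proj₁ e == proj₁ e) ∧ reachB k E (proj₂ e) y})
       (inj₁ (from T-∧ (==-refl (proj₁ e) , r)))
viaEdge⁺ {e = e} {k = k} {E = E} {y = y} (inj₂ (refl , refl)) r =
  from (T-∨ {(proj₁ e == proj₂ e) ∧ reachB k E (proj₂ e) y})
       (inj₂ (from T-∧ (==-refl (proj₂ e) , r)))

Walk⇒reachB : Walk E k x y → T (reachB k E x y)
Walk⇒reachB {k = zero} {x = x} stay = ==-refl x
Walk⇒reachB {k = suc k} {x = x} stay = from (T-∨ {x == x}) (inj₁ (==-refl x))
Walk⇒reachB {E = E} {k = suc k} {x = x} {y = y} (step e∈E J walk) =
  from (T-∨ {x == y})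
       (inj₂ (any⁺ (viaEdge k E x y) (lose e∈E (viaEdge⁺ {k = k} {E = E} {y = y} J (Walk⇒reachB walk)))))

Reach⇒Walk : ∀ {E : Edges n} {x y} → Reach E x y → Walk E n x y
Reach⇒Walk r = reachB⇒Walk _ _ _ _ (from T-≡ r)

Walk⇒Reach : ∀ {E : Edges n} {x y} → Walk E n x y → Reach E x y
Walk⇒Reach walk = to T-≡ (Walk⇒reachB walk)

Isolated : Edges n → Fin n → Set
Isolated E z = ∀ {e} → e ∈ E → ¬ Incident e z

Walk-from-isolated : Isolated E z → Walk E k z y → z ≡ y
Walk-from-isolated iso stay = refl
Walk-from-isolated iso (step e∈E J _) = contradiction (Joins⇒Incidentˡ J) (iso e∈E)

Walk-to-isolated : Isolated E z → Walk E k x z → x ≡ z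
Walk-to-isolated iso stay = refl
Walk-to-isolated iso (step e∈E J walk) with Walk-to-isolated iso walk
... | refl = contradiction (Joins⇒Incidentʳ J) (iso e∈E)

∈-removeAt⊎≡lookup : ∀ {A : Set} {a : A} {xs} → a ∈ xs → ∀ i → a ∈ removeAt xs i ⊎ a ≡ lookup xs i
∈-removeAt⊎≡lookup (here refl) zero = inj₂ refl
∈-removeAt⊎≡lookup (there a∈xs) zero = inj₁ a∈xs
∈-removeAt⊎≡lookup (here refl) (suc i) = inj₁ (here refl)
∈-removeAt⊎≡lookup (there a∈xs) (suc i) with ∈-removeAt⊎≡lookup a∈xs i
... | inj₁ a∈rest = inj₁ (there a∈rest)
... | inj₂ a≡xsᵢ = inj₂ a≡xsᵢ

∈-removeAt⇒∈ : ∀ {A : Set} {a : A} {xs} i → a ∈ removeAt xs i → a ∈ xs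
∈-removeAt⇒∈ {xs = _ ∷ _} zero a∈ = there a∈
∈-removeAt⇒∈ {xs = _ ∷ _} (suc i) (here a≡x) = here a≡x
∈-removeAt⇒∈ {xs = _ ∷ _} (suc i) (there a∈) = there (∈-removeAt⇒∈ i a∈)

module EdgeRemoval (Tr : Edges n) (i : Fin (length Tr)) where

  rest : Edges n
  rest = removeAt Tr i

  u v : Fin n
  u = proj₁ (lookup Tr i)
  v = proj₂ (lookup Tr i)

  crosses : Fin n → Fin n → Bool
  crosses x y = (reachB n rest u x ∧ reachB n rest v y) ∨ (reachB n rest v x ∧ reachB n rest u y)

  congestion≡crossings : congestion Tr i ≡ crossings crosses
  congestion≡crossings =
    trans (sum-map-tabulate (λ x → count (λ y → (toℕ x <ᵇ toℕ y) ∧ crosses x y) (allFin n)) id)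
          (sum-cong-≗ λ x → count-tabulate (λ y → (toℕ x <ᵇ toℕ y) ∧ crosses x y) id)

  -- Cut the walk after its last use of the removed edge.
  Walk-removeAt : Walk Tr k x y → Walk rest k x y ⊎ Walk rest k u y ⊎ Walk rest k v y
  Walk-removeAt stay = inj₁ stay
  Walk-removeAt (step e∈Tr J walk) with Walk-removeAt walk | ∈-removeAt⊎≡lookup e∈Tr i
  ... | inj₂ (inj₁ fromU) | _ = inj₂ (inj₁ (Walk-suc fromU))
  ... | inj₂ (inj₂ fromV) | _ = inj₂ (inj₂ (Walk-suc fromV))
  ... | inj₁ fromW | inj₁ e∈rest = inj₁ (step e∈rest J fromW)
  ... | inj₁ fromW | inj₂ refl with Joins⇒Incidentʳ J
  ...   | inj₁ refl = inj₂ (inj₁ (Walk-suc fromW))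
  ...   | inj₂ refl = inj₂ (inj₂ (Walk-suc fromW))

  reached-from-endpoint : (∀ x y → Reach Tr x y) → ∀ y → Walk rest n u y ⊎ Walk rest n v y
  reached-from-endpoint connected y with Walk-removeAt (Reach⇒Walk (connected u y))
  ... | inj₁ fromU = inj₁ fromU
  ... | inj₂ fromEnd = fromEnd

  side : Fin n → Bool
  side = reachB n rest u

  congestion-≥ : IsSpanningTreeOfK n Tr → n ∸ 1 ≤ congestion Tr i
  congestion-≥ sp = begin
    n ∸ 1                               ≡⟨ cong (_∸ 1) (size-+-size-not side) ⟨
    size side + size (not ∘ side) ∸ 1   ≤⟨ m+n∸1≤m*n u-side-nonempty v-side-nonempty ⟩
    size side * size (not ∘ side)       ≡⟨ crossings-xor side ⟨
    crossings (λ x y → side x xor side y) ≤⟨ crossings-mono xor⇒crosses ⟩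
    crossings crosses                   ≡⟨ congestion≡crossings ⟨
    congestion Tr i                     ∎
    where
      open ≤-Reasoning
      open IsSpanningTreeOfK sp

      u-side-nonempty : 1 ≤ size side
      u-side-nonempty = size-≥1 side u (Walk⇒reachB (stay {E = rest} {k = n}))

      v-side-nonempty : 1 ≤ size (not ∘ side)
      v-side-nonempty = size-≥1 (not ∘ side) v (from T-not-≡ (¬-not (acyclic i)))

      reached : ∀ z → T (side z) ⊎ T (reachB n rest v z)
      reached z with reached-from-endpoint connected z
      ... | inj₁ fromU = inj₁ (Walk⇒reachB fromU)
      ... | inj₂ fromV = inj₂ (Walk⇒reachB fromV)

      xor⇒crosses : ∀ x y → T (side x xor side y) → T (crosses x y)
      xor⇒crosses x y = xor-cut (side x) (side y) _ _ (reached x) (reached y)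

-- The least k < b with P k, or b if there is none.
least : (ℕ → Bool) → ℕ → ℕ
least P zero = 0
least P (suc b) = if P 0 then 0 else suc (least (P ∘ suc) b)

least-≤ : ∀ (P : ℕ → Bool) b k → T (P k) → least P b ≤ k
least-≤ P zero k _ = z≤n
least-≤ P (suc b) k Pk with P 0 in P0
... | true = z≤n
least-≤ P (suc b) zero Pk | false = contradiction (trans (sym P0) (to T-≡ Pk)) λ ()
least-≤ P (suc b) (suc k) Pk | false = s≤s (least-≤ (P ∘ suc) b k Pk)

least-holds : ∀ (P : ℕ → Bool) b k → k ≤ b → T (P k) → T (P (least P b))
least-holds P zero zero _ Pk = Pk
least-holds P (suc b) k k≤b Pk with P 0 in P0
... | true = from T-≡ P0
least-holds P (suc b) zero _ Pk | false = contradiction (trans (sym P0) (to T-≡ Pk)) λ ()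
least-holds P (suc b) (suc k) (s≤s k≤b) Pk | false = least-holds (P ∘ suc) b k k≤b Pk

-- Each non-root vertex w has an edge towards the root zero ending strictly closer to it; these
-- edges are distinct, so a connected graph has at least as many edges as non-root vertices.
module Distance {m} (E : Edges (suc m)) (connected : ∀ x y → Reach E x y) where

  dist : Fin (suc m) → ℕ
  dist w = least (λ k → reachB k E w zero) (suc m)

  dist-Walk : ∀ w → Walk E (dist w) w zero
  dist-Walk w = reachB⇒Walk _ E w zero
    (least-holds (λ k → reachB k E w zero) (suc m) (suc m) ≤-refl (from T-≡ (connected w zero)))

  dist-≤ : Walk E k w zero → dist w ≤ k
  dist-≤ {k = k} {w = w} walk = least-≤ (λ k → reachB k E w zero) (suc m) k (Walk⇒reachB walk)

  ParentEdge : Fin (suc m) → Fin (suc m) × Fin (suc m) → Set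
  ParentEdge w e = ∃[ w′ ] Joins e w w′ × dist w′ < dist w

  parentEdge : ∀ w → w ≢ zero → ∃[ e ] e ∈ E × ParentEdge w e
  parentEdge w w≢0 with dist w | dist-Walk w
  ... | _ | stay = contradiction refl w≢0
  ... | _ | step e∈E J walk = _ , e∈E , _ , J , s≤s (dist-≤ walk)

  ParentEdge-unique : ∀ {w w′} → ParentEdge w e → ParentEdge w′ e → w ≡ w′
  ParentEdge-unique (a , J , a<w) (b , J′ , b<w′) with Joins-sameEdge J J′
  ... | inj₁ w≡w′ = w≡w′
  ... | inj₂ (refl , refl) = contradiction a<w (<-asym b<w′)

  parentOf : ∀ w → ∃[ e ] e ∈ E × ParentEdge (suc w) e
  parentOf w = parentEdge (suc w) λ ()

  parent : Fin m → Fin (length E)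
  parent w = Any.index (proj₁ (proj₂ (parentOf w)))

  parent-injective : Injective _≡_ _≡_ parent
  parent-injective {a} {b} parentₐ≡parent_b
    with parentOf a | parentOf b
       | index-injective (setoid _) (proj₁ (proj₂ (parentOf a))) (proj₁ (proj₂ (parentOf b))) parentₐ≡parent_b
  ... | _ , _ , pₐ | _ , _ , p_b | refl = suc-injective (ParentEdge-unique pₐ p_b)

connected⇒n∸1≤length : ∀ {E : Edges n} → (∀ x y → Reach E x y) → n ∸ 1 ≤ length E
connected⇒n∸1≤length {zero} _ = z≤n
connected⇒n∸1≤length {suc m} {E} connected = injective⇒≤ (Distance.parent-injective E connected)

radialFrom-∈⁻ : ∀ (c : Fin n) l → e ∈ radialFrom c l → proj₁ e ≡ c × proj₂ e ≢ c × proj₂ e ∈ l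
radialFrom-∈⁻ c (x ∷ xs) e∈ with c ≟ x
... | yes _ = let (e₁≡c , e₂≢c , e₂∈xs) = radialFrom-∈⁻ c xs e∈ in e₁≡c , e₂≢c , there e₂∈xs
radialFrom-∈⁻ c (x ∷ xs) (here refl) | no c≢x = refl , c≢x ∘ sym , here refl
radialFrom-∈⁻ c (x ∷ xs) (there e∈) | no _ =
  let (e₁≡c , e₂≢c , e₂∈xs) = radialFrom-∈⁻ c xs e∈ in e₁≡c , e₂≢c , there e₂∈xs

radialFrom-∈⁺ : ∀ (c : Fin n) l → y ∈ l → y ≢ c → (c , y) ∈ radialFrom c l
radialFrom-∈⁺ c (x ∷ xs) y∈ y≢c with c ≟ x
radialFrom-∈⁺ c (x ∷ xs) (here refl) y≢c | yes c≡y = contradiction (sym c≡y) y≢c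
radialFrom-∈⁺ c (x ∷ xs) (there y∈) y≢c | yes _ = radialFrom-∈⁺ c xs y∈ y≢c
radialFrom-∈⁺ c (x ∷ xs) (here refl) y≢c | no _ = here refl
radialFrom-∈⁺ c (x ∷ xs) (there y∈) y≢c | no _ = there (radialFrom-∈⁺ c xs y∈ y≢c)

length-radialFrom : ∀ (c : Fin n) l → length (radialFrom c l) ≡ count (not ∘ (c ==_)) l
length-radialFrom c [] = refl
length-radialFrom c (x ∷ xs) with c ≟ x
... | yes _ = length-radialFrom c xs
... | no _ = cong suc (length-radialFrom c xs)

radialFrom-removeAt : ∀ (c : Fin n) {l} → Unique l → ∀ i →
                      e ∈ removeAt (radialFrom c l) i → proj₂ e ≢ proj₂ (lookup (radialFrom c l) i)
radialFrom-removeAt c {x ∷ xs} (x∉xs ∷ unique) i e∈ with c ≟ x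
... | yes _ = radialFrom-removeAt c unique i e∈
radialFrom-removeAt c {x ∷ xs} (x∉xs ∷ unique) zero e∈ | no _ =
  λ e₂≡x → All.lookup x∉xs (proj₂ (proj₂ (radialFrom-∈⁻ c xs e∈))) (sym e₂≡x)
radialFrom-removeAt c {x ∷ xs} (x∉xs ∷ unique) (suc i) (here refl) | no _ =
  All.lookup x∉xs (proj₂ (proj₂ (radialFrom-∈⁻ c xs (∈-lookup i))))
radialFrom-removeAt c {x ∷ xs} (x∉xs ∷ unique) (suc i) (there e∈) | no _ =
  radialFrom-removeAt c unique i e∈

module Star (c : Fin n) where

  length-radial : length (radial c) ≡ n ∸ 1
  length-radial = begin
    length (radial c)                   ≡⟨ length-radialFrom c (allFin n) ⟩
    count (not ∘ (c ==_)) (allFin n)    ≡⟨ count-tabulate (not ∘ (c ==_)) id ⟩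
    size (not ∘ (c ==_))                ≡⟨ size-not-== c ⟩
    n ∸ 1                               ∎
    where open ≡-Reasoning

  radial-connected : 2 ≤ n → ∀ x y → Reach (radial c) x y
  radial-connected 2≤n x y = Walk⇒Reach (Walk-mono 2≤n (via-centre x y))
    where
      spoke : ∀ {y} → y ≢ c → (c , y) ∈ radial c
      spoke y≢c = radialFrom-∈⁺ c (allFin n) (∈-allFin _) y≢c

      from-centre : ∀ y → Walk (radial c) 1 c y
      from-centre y with y ≟ c
      ... | yes refl = stay
      ... | no y≢c = step (spoke y≢c) (inj₁ (refl , refl)) stay

      via-centre : ∀ x y → Walk (radial c) 2 x y
      via-centre x y with x ≟ c
      ... | yes refl = Walk-suc (from-centre y)
      ... | no x≢c = step (spoke x≢c) (inj₂ (refl , refl)) (from-centre y)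

  module _ (i : Fin (length (radial c))) where
    open EdgeRemoval (radial c) i

    centre : u ≡ c
    centre = proj₁ (radialFrom-∈⁻ c (allFin n) (∈-lookup i))

    leaf≢centre : v ≢ c
    leaf≢centre = proj₁ (proj₂ (radialFrom-∈⁻ c (allFin n) (∈-lookup i)))

    leaf-isolated : Isolated rest v
    leaf-isolated e∈rest (inj₁ e₁≡v) =
      leaf≢centre (trans (sym e₁≡v) (proj₁ (radialFrom-∈⁻ c (allFin n) (∈-removeAt⇒∈ i e∈rest))))
    leaf-isolated e∈rest (inj₂ e₂≡v) = radialFrom-removeAt c (allFin⁺ n) i e∈rest e₂≡v

    leaf-unreachable : ¬ Walk rest k u v
    leaf-unreachable walk = leaf≢centre (trans (sym (Walk-to-isolated leaf-isolated walk)) centre)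

    reaches-leaf : T (reachB n rest v z) → T (v == z)
    reaches-leaf r = fromWitness (Walk-from-isolated leaf-isolated (reachB⇒Walk n rest v _ r))

    misses-leaf : T (reachB n rest u z) → ¬ T (v == z)
    misses-leaf {z} r v≡z with ==-sound {x = v} {z} v≡z
    ... | refl = leaf-unreachable (reachB⇒Walk n rest u v r)

    crosses⇒xor : ∀ x y → T (crosses x y) → T ((v == x) xor (v == y))
    crosses⇒xor x y cr with to (T-∨ {reachB n rest u x ∧ reachB n rest v y}) cr
    ... | inj₁ q = let (ux , vy) = to (T-∧ {reachB n rest u x}) q in
                   xor-intro (v == x) (v == y) (inj₂ (misses-leaf ux , reaches-leaf vy))
    ... | inj₂ q = let (vx , uy) = to (T-∧ {reachB n rest v x}) q in
                   xor-intro (v == x) (v == y) (inj₁ (reaches-leaf vx , misses-leaf uy))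

    congestion-≤ : congestion (radial c) i ≤ n ∸ 1
    congestion-≤ = begin
      congestion (radial c) i                       ≡⟨ congestion≡crossings ⟩
      crossings crosses                             ≤⟨ crossings-mono crosses⇒xor ⟩
      crossings (λ x y → (v == x) xor (v == y))     ≡⟨ crossings-xor (v ==_) ⟩
      size (v ==_) * size (not ∘ (v ==_))           ≡⟨ cong₂ _*_ (size-== v) (size-not-== v) ⟩
      1 * (n ∸ 1)                                   ≡⟨ *-identityˡ (n ∸ 1) ⟩
      n ∸ 1                                         ∎
      where open ≤-Reasoning

  radial-isSpanningTree : 2 ≤ n → IsSpanningTreeOfK n (radial c)
  radial-isSpanningTree 2≤n = record
    { edgesOfK  = λ i u≡v → leaf≢centre i (trans (sym u≡v) (centre i))
    ; connected = radial-connected 2≤n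
    ; acyclic   = λ i reach → leaf-unreachable i (Reach⇒Walk reach)
    }

  radial-congestion : 2 ≤ n → ∀ i → congestion (radial c) i ≡ n ∸ 1
  radial-congestion 2≤n i =
    ≤-antisym (congestion-≤ i) (EdgeRemoval.congestion-≥ (radial c) i (radial-isSpanningTree 2≤n))

congestionPowSum≡∑ : ∀ p (Tr : Edges n) →
                     congestionPowSum p Tr ≡ ∑[ i < length Tr ] (congestion Tr i ^ p)
congestionPowSum≡∑ p Tr = sum-map-tabulate (λ i → congestion Tr i ^ p) id

congestionPowSum-≥ : ∀ p {Tr : Edges n} → IsSpanningTreeOfK n Tr →
                     (n ∸ 1) ^ (p + 1) ≤ congestionPowSum p Tr
congestionPowSum-≥ {n} p {Tr} sp = begin
  (n ∸ 1) ^ (p + 1)                           ≡⟨ ^-+-1 (n ∸ 1) p ⟩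
  (n ∸ 1) * (n ∸ 1) ^ p                       ≤⟨ *-monoˡ-≤ _ (connected⇒n∸1≤length connected) ⟩
  length Tr * (n ∸ 1) ^ p                     ≡⟨ ∑-const (length Tr) _ ⟨
  ∑[ i < length Tr ] ((n ∸ 1) ^ p)            ≤⟨ ∑-mono-≤ (λ i → ^-monoˡ-≤ p (EdgeRemoval.congestion-≥ Tr i sp)) ⟩
  ∑[ i < length Tr ] (congestion Tr i ^ p)      ≡⟨ congestionPowSum≡∑ p Tr ⟨
  congestionPowSum p Tr                       ∎
  where
    open ≤-Reasoning
    open IsSpanningTreeOfK sp

radial-congestionPowSum : ∀ p (c : Fin n) → 2 ≤ n → congestionPowSum p (radial c) ≡ (n ∸ 1) ^ (p + 1)
radial-congestionPowSum {n} p c 2≤n = begin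
  congestionPowSum p (radial c)                     ≡⟨ congestionPowSum≡∑ p (radial c) ⟩
  ∑[ i < length (radial c) ] (congestion (radial c) i ^ p)
                                                    ≡⟨ sum-cong-≗ (λ i → cong (_^ p) (radial-congestion 2≤n i)) ⟩
  ∑[ i < length (radial c) ] ((n ∸ 1) ^ p)          ≡⟨ ∑-const (length (radial c)) _ ⟩
  length (radial c) * (n ∸ 1) ^ p                   ≡⟨ cong (_* (n ∸ 1) ^ p) length-radial ⟩
  (n ∸ 1) * (n ∸ 1) ^ p                             ≡⟨ ^-+-1 (n ∸ 1) p ⟨
  (n ∸ 1) ^ (p + 1)                                 ∎
  where
    open ≡-Reasoning
    open Star c

mainTheorem8 : ∀ (n p : ℕ) → 2 ≤ n → 1 ≤ p →
    (∀ (c : Fin n) → IsSpanningTreeOfK n (radial c)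
                     × congestionPowSum p (radial c) ≡ (n ∸ 1) ^ (p + 1))
    × (∀ (Tr : Edges n) → IsSpanningTreeOfK n Tr →
                     (n ∸ 1) ^ (p + 1) ≤ congestionPowSum p Tr)
mainTheorem8 n p 2≤n _ =
  (λ c → Star.radial-isSpanningTree c 2≤n , radial-congestionPowSum p c 2≤n) ,
  (λ Tr → congestionPowSum-≥ p)
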